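{- Let $H$ and $T$ be fixed graphs with $T$ $2$-balanced. (i) If $m_2(H)\le m_2(T)$, then $m_T(F^e_{T,H})\le m_2(T)$. (ii) If $m_2(H)>m_2(T)$, then every $T$-covering $F$ of $H$ satisfies $m_T(F)>m_2(T)$.
   Context: For a graph $F$, $v_F,e_F$ are its numbers of vertices and edges. The $2$-density of a graph $H$ with at least two edges is $m_2(H)=\max\{(e_{H'}-1)/(v_{H'}-2): H'\subseteq H,\ e_{H'}\ge2\}$; $T$ (with at least two edges) is $2$-balanced if $m_2(T)=(e_T-1)/(v_T-2)$. A $T$-covering of $H$ is a collection $F=\{T_1,\dots,T_k\}$ of pairwise edge-disjoint copies of $T$ whose union contains a copy of $H$ and which is minimal: for each $i$, the union of the members of $F\setminus\{T_i\}$ contains no copy of $H$. For a collection $F'$ of copies of $T$, $U(F')$ is the union of its members. The $T$-density of a $T$-covering $F$ is $m_T(F)=\max\{(e_{U(F')}-e_T)/(v_{U(F')}-v_T): F'\subseteq F,\ |F'|\ge2\}$. $F^e_{T,H}$ is the $T$-covering of $H$ by $e_H$ copies of $T$, each meeting $H$ in exactly one edge and otherwise vertex-disjoint from the other copies. -}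

module Defs where

open import Data.Nat using (ℕ; zero; suc; _+_; _*_; _∸_; _≤_; _<_; _<ᵇ_)
open import Data.Bool using (Bool; true; false; _∧_; _∨_; if_then_else_; T)
open import Data.Fin using (Fin; zero; suc; toℕ; _≟_)
open import Data.Product using (Σ; ∃; _×_; _,_; proj₁; proj₂)
open import Data.Sum using (_⊎_)
open import Data.Empty using (⊥)
open import Relation.Nullary using (¬_)
open import Relation.Nullary.Decidable using (⌊_⌋)
open import Relation.Binary.PropositionalEquality using (_≡_; _≢_)
open import Function using (_∘_)

countFin : ∀ {n} → (Fin n → Bool) → ℕ
countFin {zero}  f = 0
countFin {suc n} f = (if f zero then 1 else 0) + countFin (f ∘ suc)

sumFin : ∀ {n} → (Fin n → ℕ) → ℕ
sumFin {zero}  f = 0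
sumFin {suc n} f = f zero + sumFin (f ∘ suc)

anyFin : ∀ {n} → (Fin n → Bool) → Bool
anyFin {zero}  f = false
anyFin {suc n} f = f zero ∨ anyFin (f ∘ suc)

countPairs : ∀ {n} → (Fin n → Fin n → Bool) → ℕ
countPairs r = sumFin λ i → countFin λ j → (toℕ i <ᵇ toℕ j) ∧ r i j

Injective : {A B : Set} → (A → B) → Set
Injective f = ∀ i j → f i ≡ f j → i ≡ j

record Graph : Set where
  field
    n   : ℕ
    adj : Fin n → Fin n → Bool
    sym : ∀ i j → adj i j ≡ adj j i
    irr : ∀ i → adj i i ≡ false
open Graph public

vG : Graph → ℕ
vG G = n G

eG : Graph → ℕ
eG G = countPairs (adj G)

record Sub (G : Graph) : Set where
  field
    vs     : Fin (n G) → Bool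
    es     : Fin (n G) → Fin (n G) → Bool
    es-sym : ∀ i j → es i j ≡ es j i
    es⊆    : ∀ i j → T (es i j) → T (adj G i j)
    es-end : ∀ i j → T (es i j) → T (vs i)
open Sub public

vSub : ∀ {G} → Sub G → ℕ
vSub S = countFin (vs S)

eSub : ∀ {G} → Sub G → ℕ
eSub S = countPairs (es S)

-- Comparisons of fractions a/b with c/d by cross multiplication
-- (denominators are positive wherever they are defined; a/0 with a > 0
-- is read as +∞, which is what cross multiplication gives).

_/_≤'_/_ : ℕ → ℕ → ℕ → ℕ → Set
a / b ≤' c / d = a * d ≤ c * b

_/_>'_/_ : ℕ → ℕ → ℕ → ℕ → Set
a / b >' c / d = c * b < a * d

-- 2-density m₂(G) = max{(e_{H'}-1)/(v_{H'}-2) : H' ⊆ G, e_{H'} ≥ 2},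
-- compared with a fraction p/q.

M2≤ : Graph → ℕ → ℕ → Set
M2≤ G p q = ∀ (S : Sub G) → 2 ≤ eSub S →
  (eSub S ∸ 1) / (vSub S ∸ 2) ≤' p / q

M2> : Graph → ℕ → ℕ → Set
M2> G p q = Σ (Sub G) λ S → 2 ≤ eSub S ×
  (eSub S ∸ 1) / (vSub S ∸ 2) >' p / q

-- T is 2-balanced: e_T ≥ 2 and m₂(T) = (e_T - 1)/(v_T - 2)
-- (the whole of T attains this value, so equality of the maximum with it
--  means every admissible subgraph has ratio ≤ it).
TwoBalanced : Graph → Set
TwoBalanced G = 2 ≤ eG G × M2≤ G (eG G ∸ 1) (vG G ∸ 2)

-- Collections of copies of T inside a host vertex set Fin N.
-- A copy of T is an injective map φ : V(T) → Fin N; its edges are the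
-- images of the edges of T.

copyEdge : (Tg : Graph) {N : ℕ} → (Fin (n Tg) → Fin N) → Fin N → Fin N → Bool
copyEdge Tg φ x y = anyFin λ i → anyFin λ j →
  ⌊ φ i ≟ x ⌋ ∧ ⌊ φ j ≟ y ⌋ ∧ adj Tg i j

copyVert : (Tg : Graph) {N : ℕ} → (Fin (n Tg) → Fin N) → Fin N → Bool
copyVert Tg φ x = anyFin λ i → ⌊ φ i ≟ x ⌋

record Collection (Tg : Graph) : Set where
  field
    N     : ℕ
    k     : ℕ
    cp    : Fin k → Fin (n Tg) → Fin N
    cpInj : ∀ c → Injective (cp c)
open Collection public

-- sub-collections F' ⊆ F are given by indicator functions on Fin k
module _ {Tg : Graph} (F : Collection Tg) where
  UVert : (Fin (k F) → Bool) → Fin (N F) → Bool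
  UVert S x = anyFin λ c → S c ∧ copyVert Tg (cp F c) x

  UEdge : (Fin (k F) → Bool) → Fin (N F) → Fin (N F) → Bool
  UEdge S x y = anyFin λ c → S c ∧ copyEdge Tg (cp F c) x y

  vU : (Fin (k F) → Bool) → ℕ
  vU S = countFin (UVert S)

  eU : (Fin (k F) → Bool) → ℕ
  eU S = countPairs (UEdge S)

  -- U(F') contains a copy of H (not necessarily induced)
  ContainsCopy : Graph → (Fin (k F) → Bool) → Set
  ContainsCopy H S = Σ (Fin (n H) → Fin (N F)) λ ψ → Injective ψ ×
    (∀ a b → T (adj H a b) → T (UEdge S (ψ a) (ψ b)))

  allC : Fin (k F) → Bool
  allC _ = true

  allBut : Fin (k F) → Fin (k F) → Bool
  allBut c d = if ⌊ c ≟ d ⌋ then false else true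

  EdgeDisjoint : Set
  EdgeDisjoint = ∀ c d → c ≢ d → ∀ x y →
    T (copyEdge Tg (cp F c) x y) → T (copyEdge Tg (cp F d) x y) → ⊥

  -- m_T(F) = max{(e_{U(F')} - e_T)/(v_{U(F')} - v_T) : F' ⊆ F, |F'| ≥ 2}
  -- m_T(F) ≤ p/q
  MT≤ : ℕ → ℕ → Set
  MT≤ p q = ∀ (S : Fin (k F) → Bool) → 2 ≤ countFin S →
    (eU S ∸ eG Tg) / (vU S ∸ vG Tg) ≤' p / q

  MT> : ℕ → ℕ → Set
  MT> p q = Σ (Fin (k F) → Bool) λ S → 2 ≤ countFin S ×
    (eU S ∸ eG Tg) / (vU S ∸ vG Tg) >' p / q

record IsCovering (Tg H : Graph) (F : Collection Tg) : Set where
  field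
    disjoint : EdgeDisjoint F
    covers   : ContainsCopy F H (allC F)
    minimal  : ∀ c → ¬ ContainsCopy F H (allBut F c)

-- F is (a realisation of) F^e_{T,H}: e_H copies of T, indexed by the
-- edges of H, each meeting the copy ψ(H) in exactly its edge, and
-- otherwise vertex-disjoint from the other copies.
record IsFe (Tg H : Graph) (F : Collection Tg) : Set where
  field
    k≡    : k F ≡ eG H
    ψ     : Fin (n H) → Fin (N F)
    ψInj  : Injective ψ
    ends  : Fin (k F) → Fin (n H) × Fin (n H)
    endsEdge : ∀ c → T (adj H (proj₁ (ends c)) (proj₂ (ends c)))
    endsOrd  : ∀ c → toℕ (proj₁ (ends c)) < toℕ (proj₂ (ends c))
    endsInj  : Injective ends
    endsSurj : ∀ a b → T (adj H a b) → toℕ a < toℕ b → ∃ λ c → ends c ≡ (a , b)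
    hasEdge  : ∀ c → T (copyEdge Tg (cp F c) (ψ (proj₁ (ends c))) (ψ (proj₂ (ends c))))
    meetH    : ∀ c i a → cp F c i ≡ ψ a →
                 (a ≡ proj₁ (ends c)) ⊎ (a ≡ proj₂ (ends c))
    otherwiseDisj : ∀ c d → c ≢ d → ∀ i j → cp F c i ≡ cp F d j →
                 ∃ λ a → cp F c i ≡ ψ a

module Submission where

-- Lemma 3.6.  For a sub-collection F′ of s copies of T, both parts compare
-- e_{U(F′)} and v_{U(F′)} with the size of a subgraph H′ of H read off
-- from F′, and then apply the density hypothesis to H′.  Write
-- a = v_T − 2 and b = e_T − 1, so m₂(T) = b/a.
--  (i) For F = F^e_{T,H}, H′ is formed by the s edges of H carried by F′.
--      Then e_U ≤ s e_T, e_{H′} ≥ s, and since each copy meets ψ(H) in only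
--      two vertices while distinct copies meet only on ψ(H),
--      v_U ≥ v_{H′} + s a.  With (e_{H′} − 1) a ≤ b (v_{H′} − 2) this gives
--      (e_U − e_T) a ≤ b (v_U − v_T).
-- (ii) Given H′ ⊆ H with m₂(H′) > m₂(T) and a covering F, select the copies
--      containing an edge of ψ(H′) and let J_c ⊆ T be the trace of ψ(H′)
--      on copy c.

open import Defs renaming (sym to adj-sym)
open import Data.Nat using (ℕ; zero; suc; _+_; _*_; _∸_; _≤_; _<_; _<ᵇ_; z≤n; s≤s)
open import Data.Nat.Properties hiding (_≟_)
open import Data.Nat.Tactic.RingSolver using (solve-∀)
open import Data.Bool using (Bool; true; false; _∧_; _∨_; not; if_then_else_; T)
open import Data.Bool.Properties using (∧-comm; ∧-assoc; ∧-identityʳ; ∨-comm; T-∧; T-∨)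
open import Data.Fin using (Fin; zero; suc; toℕ; _≟_)
open import Data.Fin.Properties using (toℕ-injective) renaming (suc-injective to fsuc-injective)
open import Data.Product using (∃; _×_; _,_; proj₁; proj₂)
open import Data.Sum using (_⊎_; inj₁; inj₂)
open import Data.Empty using (⊥-elim)
open import Data.Unit using (tt)
open import Function using (_∘_; Equivalence)
open import Relation.Nullary using (¬_; yes; no)
open import Relation.Nullary.Decidable using (⌊_⌋; toWitness; fromWitness; ⌊⌋-map′)
open import Relation.Binary.PropositionalEquality
  using (_≡_; _≢_; refl; sym; trans; cong; cong₂; subst; subst₂; module ≡-Reasoning)
open import Relation.Binary.Definitions using (tri<; tri≈; tri>)
open import Algebra.Properties.CommutativeMonoid.Sum +-0-commutativeMonoid
  using (sum; sum-cong-≗; sum-replicate-zero; ∑-distrib-+; ∑-comm)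
open import Algebra.Properties.Semiring.Sum +-*-semiring
  using (*-distribˡ-sum; *-distribʳ-sum)

-- Booleans.  The characteristic function of a Boolean is written as in the
-- definition of countFin, so that countFin f unfolds to a sum of χ (f x).
χ : Bool → ℕ
χ b = if b then 1 else 0

χ-∧ : ∀ a b → χ (a ∧ b) ≡ χ a * χ b
χ-∧ true  b = sym (+-identityʳ (χ b))
χ-∧ false b = refl

χ-true : ∀ {b} → T b → χ b ≡ 1
χ-true {true} _ = refl

χ-false : ∀ {b} → ¬ T b → χ b ≡ 0
χ-false {true}  ¬b = ⊥-elim (¬b tt)
χ-false {false} _  = refl

χ-mono : ∀ {a b} → (T a → T b) → χ a ≤ χ b
χ-mono {true}  a⇒b = ≤-reflexive (sym (χ-true (a⇒b tt)))
χ-mono {false} _   = z≤n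

χ-∨ : ∀ a b → χ (a ∨ b) ≤ χ a + χ b
χ-∨ true  b = s≤s z≤n
χ-∨ false b = ≤-refl

χ-split : ∀ a b → χ a ≡ χ (a ∧ b) + χ (a ∧ not b)
χ-split true  true  = refl
χ-split true  false = refl
χ-split false b     = refl

∧-intro : ∀ {a b} → T a → T b → T (a ∧ b)
∧-intro ta tb = Equivalence.from T-∧ (ta , tb)

∧-fst : ∀ {a b} → T (a ∧ b) → T a
∧-fst t = proj₁ (Equivalence.to T-∧ t)

∧-snd : ∀ {a b} → T (a ∧ b) → T b
∧-snd t = proj₂ (Equivalence.to T-∧ t)

∨-inl : ∀ {a b} → T a → T (a ∨ b)
∨-inl t = Equivalence.from T-∨ (inj₁ t)

∨-inr : ∀ {a b} → T b → T (a ∨ b)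
∨-inr t = Equivalence.from T-∨ (inj₂ t)

∨-elim : ∀ {a b} → T (a ∨ b) → T a ⊎ T b
∨-elim = Equivalence.to T-∨

not-T : ∀ {b} → T (not b) → ¬ T b
not-T {true} () _

T-ext : ∀ {a b} → (T a → T b) → (T b → T a) → a ≡ b
T-ext {true}  {true}  _ _ = refl
T-ext {true}  {false} f _ = ⊥-elim (f tt)
T-ext {false} {true}  _ g = ⊥-elim (g tt)
T-ext {false} {false} _ _ = refl

any-intro : ∀ {n} (f : Fin n → Bool) i → T (f i) → T (anyFin f)
any-intro f zero    t = ∨-inl t
any-intro f (suc i) t = ∨-inr {f zero} (any-intro (f ∘ suc) i t)

any-witness : ∀ {n} (f : Fin n → Bool) → T (anyFin f) → ∃ λ i → T (f i)
any-witness {suc n} f t with ∨-elim {f zero} t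
... | inj₁ t₀ = zero , t₀
... | inj₂ t₁ with any-witness (f ∘ suc) t₁
...   | i , tᵢ = suc i , tᵢ

any-cong : ∀ {n} {f g : Fin n → Bool} → (∀ i → f i ≡ g i) → anyFin f ≡ anyFin g
any-cong {zero}  _ = refl
any-cong {suc n} e = cong₂ _∨_ (e zero) (any-cong (e ∘ suc))

any-∧ʳ : ∀ {n} (f : Fin n → Bool) b → anyFin f ∧ b ≡ anyFin (λ i → f i ∧ b)
any-∧ʳ f b = T-ext
  (λ t → let i , tᵢ = any-witness f (∧-fst t) in any-intro _ i (∧-intro tᵢ (∧-snd t)))
  (λ t → let i , tᵢ = any-witness _ t in ∧-intro (any-intro f i (∧-fst tᵢ)) (∧-snd tᵢ))

χ-any≤ : ∀ {n} (f : Fin n → Bool) → χ (anyFin f) ≤ sum (χ ∘ f)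
χ-any≤ {zero}  f = z≤n
χ-any≤ {suc n} f = ≤-trans (χ-∨ (f zero) _) (+-monoʳ-≤ (χ (f zero)) (χ-any≤ (f ∘ suc)))

χ-any≡ : ∀ {n} (f : Fin n → Bool) → (∀ i j → T (f i) → T (f j) → i ≡ j) →
  χ (anyFin f) ≡ sum (χ ∘ f)
χ-any≡ {zero}  f _ = refl
χ-any≡ {suc n} f unique with f zero in eq
... | true  = cong suc (sym (none (λ i → f (suc i)) λ i t → zero≢suc (unique zero (suc i) (subst T (sym eq) tt) t)))
  where
  zero≢suc : ∀ {i : Fin n} → zero ≢ suc i
  zero≢suc ()
  none : ∀ {m} (g : Fin m → Bool) → (∀ i → ¬ T (g i)) → sum (χ ∘ g) ≡ 0
  none {zero}  g _ = refl
  none {suc m} g h = cong₂ _+_ (χ-false (h zero)) (none (g ∘ suc) (h ∘ suc))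
... | false = χ-any≡ (f ∘ suc) λ i j tᵢ tⱼ → fsuc-injective (unique (suc i) (suc j) tᵢ tⱼ)

sumFin≡sum : ∀ {n} (f : Fin n → ℕ) → sumFin f ≡ sum f
sumFin≡sum {zero}  f = refl
sumFin≡sum {suc n} f = cong (f zero +_) (sumFin≡sum (f ∘ suc))

sum-mono : ∀ {n} {f g : Fin n → ℕ} → (∀ i → f i ≤ g i) → sum f ≤ sum g
sum-mono {zero}  _   = z≤n
sum-mono {suc n} f≤g = +-mono-≤ (f≤g zero) (sum-mono (f≤g ∘ suc))

sum-term : ∀ {n} (f : Fin n → ℕ) i → f i ≤ sum f
sum-term f zero    = m≤m+n _ _
sum-term f (suc i) = ≤-trans (sum-term (f ∘ suc) i) (m≤n+m _ _)

sum-pos : ∀ {n} (f : Fin n → ℕ) → 1 ≤ sum f → ∃ λ i → 1 ≤ f i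
sum-pos {suc n} f pos with f zero in eq
... | suc _ = zero , subst (1 ≤_) (sym eq) (s≤s z≤n)
... | zero  = let i , posᵢ = sum-pos (f ∘ suc) pos in suc i , posᵢ

∑∈ : ∀ {n} → (Fin n → Bool) → (Fin n → ℕ) → ℕ
∑∈ S w = sum λ x → χ (S x) * w x

syntax ∑∈ S (λ x → w) = ∑[ x ∈ S ] w

countFin≡∑∈ : ∀ {n} (S : Fin n → Bool) → countFin S ≡ ∑[ x ∈ S ] 1
countFin≡∑∈ {zero}  S = refl
countFin≡∑∈ {suc n} S = cong₂ _+_ (sym (*-identityʳ _)) (countFin≡∑∈ (S ∘ suc))

∑∈-cong : ∀ {n} {S S′ : Fin n → Bool} (w : Fin n → ℕ) → (∀ x → S x ≡ S′ x) → ∑∈ S w ≡ ∑∈ S′ w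
∑∈-cong w S≗S′ = sum-cong-≗ λ x → cong (λ b → χ b * w x) (S≗S′ x)

∑∈-mono : ∀ {n} {S S′ : Fin n → Bool} (w : Fin n → ℕ) →
  (∀ x → T (S x) → T (S′ x)) → ∑∈ S w ≤ ∑∈ S′ w
∑∈-mono w S⊆S′ = sum-mono λ x → *-monoˡ-≤ (w x) (χ-mono (S⊆S′ x))

∑∈-mono-w : ∀ {n} (S : Fin n → Bool) {w w′ : Fin n → ℕ} →
  (∀ x → T (S x) → w x ≤ w′ x) → ∑∈ S w ≤ ∑∈ S w′
∑∈-mono-w S w≤w′ = sum-mono pointwise
  where
  pointwise : ∀ x → χ (S x) * _ ≤ χ (S x) * _
  pointwise x with S x in eq
  ... | true  = *-monoʳ-≤ 1 (w≤w′ x (subst T (sym eq) tt))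
  ... | false = z≤n

∑∈-+ : ∀ {n} (S : Fin n → Bool) (w w′ : Fin n → ℕ) →
  ∑[ x ∈ S ] (w x + w′ x) ≡ ∑∈ S w + ∑∈ S w′
∑∈-+ S w w′ = trans (sum-cong-≗ λ x → *-distribˡ-+ (χ (S x)) (w x) (w′ x))
                    (∑-distrib-+ (λ x → χ (S x) * w x) (λ x → χ (S x) * w′ x))

∑∈-scale : ∀ {n} (S : Fin n → Bool) k (w : Fin n → ℕ) →
  ∑[ x ∈ S ] (k * w x) ≡ k * ∑∈ S w
∑∈-scale S k w = trans (sum-cong-≗ λ x → swap (χ (S x)) k (w x))
                       (sym (*-distribˡ-sum k (λ x → χ (S x) * w x)))
  where
  swap : ∀ a b c → a * (b * c) ≡ b * (a * c)
  swap = solve-∀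

∑∈-const : ∀ {n} (S : Fin n → Bool) k → ∑[ x ∈ S ] k ≡ countFin S * k
∑∈-const S k = begin
  ∑[ x ∈ S ] k             ≡⟨ sum-cong-≗ (λ x → cong (χ (S x) *_) (sym (*-identityʳ k))) ⟩
  ∑[ x ∈ S ] (k * 1)       ≡⟨ ∑∈-scale S k (λ _ → 1) ⟩
  k * ∑[ x ∈ S ] 1         ≡⟨ cong (k *_) (sym (countFin≡∑∈ S)) ⟩
  k * countFin S           ≡⟨ *-comm k _ ⟩
  countFin S * k           ∎
  where open ≡-Reasoning

∑∈-∧ : ∀ {n} b (S : Fin n → Bool) (w : Fin n → ℕ) →
  ∑[ x ∈ (λ x → b ∧ S x) ] w x ≡ χ b * ∑∈ S w
∑∈-∧ b S w = trans (sum-cong-≗ λ x → trans (cong (_* w x) (χ-∧ b (S x))) (*-assoc (χ b) _ _))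
                   (sym (*-distribˡ-sum (χ b) (λ x → χ (S x) * w x)))

∑∈-single : ∀ {n} (u : Fin n) (w : Fin n → ℕ) → ∑[ x ∈ (λ x → ⌊ u ≟ x ⌋) ] w x ≡ w u
∑∈-single {suc n} zero    w = trans (cong₂ _+_ (+-identityʳ (w zero)) (sum-replicate-zero n)) (+-identityʳ _)
∑∈-single {suc n} (suc u) w =
  trans (sum-cong-≗ λ x → cong (λ b → χ b * w (suc x)) (⌊⌋-map′ _ _ (u ≟ x)))
        (∑∈-single u (w ∘ suc))

∑∈-union≤ : ∀ {n k} (R : Fin k → Fin n → Bool) (w : Fin n → ℕ) →
  ∑[ x ∈ (λ x → anyFin λ c → R c x) ] w x ≤ sum (λ c → ∑∈ (R c) w)
∑∈-union≤ R w = begin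
  sum (λ x → χ (anyFin λ c → R c x) * w x)    ≤⟨ sum-mono (λ x → *-monoˡ-≤ (w x) (χ-any≤ (λ c → R c x))) ⟩
  sum (λ x → sum (λ c → χ (R c x)) * w x)     ≡⟨ sum-cong-≗ (λ x → *-distribʳ-sum (w x) (λ c → χ (R c x))) ⟩
  sum (λ x → sum (λ c → χ (R c x) * w x))     ≡⟨ ∑-comm (λ x c → χ (R c x) * w x) ⟩
  sum (λ c → ∑∈ (R c) w)                      ∎
  where open ≤-Reasoning

∑∈-union≡ : ∀ {n k} (R : Fin k → Fin n → Bool) (w : Fin n → ℕ) →
  (∀ x c d → T (R c x) → T (R d x) → c ≡ d) →
  ∑[ x ∈ (λ x → anyFin λ c → R c x) ] w x ≡ sum (λ c → ∑∈ (R c) w)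
∑∈-union≡ R w disjoint = begin
  sum (λ x → χ (anyFin λ c → R c x) * w x)    ≡⟨ sum-cong-≗ (λ x → cong (_* w x) (χ-any≡ (λ c → R c x) (disjoint x))) ⟩
  sum (λ x → sum (λ c → χ (R c x)) * w x)     ≡⟨ sum-cong-≗ (λ x → *-distribʳ-sum (w x) (λ c → χ (R c x))) ⟩
  sum (λ x → sum (λ c → χ (R c x) * w x))     ≡⟨ ∑-comm (λ x c → χ (R c x) * w x) ⟩
  sum (λ c → ∑∈ (R c) w)                      ∎
  where open ≡-Reasoning

∑∈-split : ∀ {n} (S g : Fin n → Bool) (w : Fin n → ℕ) →
  ∑∈ S w ≡ ∑[ x ∈ (λ x → S x ∧ g x) ] w x + ∑[ x ∈ (λ x → S x ∧ not (g x)) ] w x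
∑∈-split S g w = trans (sum-cong-≗ λ x → trans (cong (_* w x) (χ-split (S x) (g x)))
                                             (*-distribʳ-+ (w x) (χ (S x ∧ g x)) (χ (S x ∧ not (g x)))))
                       (∑-distrib-+ (λ x → χ (S x ∧ g x) * w x) (λ x → χ (S x ∧ not (g x)) * w x))

∑∈-witness : ∀ {n} (S : Fin n → Bool) (w : Fin n → ℕ) → 1 ≤ ∑∈ S w → ∃ λ x → T (S x)
∑∈-witness S w pos with sum-pos (λ x → χ (S x) * w x) pos
... | x , posₓ = x , member (S x) posₓ
  where
  member : ∀ b → 1 ≤ χ b * w x → T b
  member true _ = tt

countFin≡sum : ∀ {n} (S : Fin n → Bool) → countFin S ≡ sum (χ ∘ S)
countFin≡sum {zero}  S = refl
countFin≡sum {suc n} S = cong (χ (S zero) +_) (countFin≡sum (S ∘ suc))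

count-all : ∀ n → countFin {n} (λ _ → true) ≡ n
count-all zero    = refl
count-all (suc n) = cong suc (count-all n)

count-cong : ∀ {n} {S S′ : Fin n → Bool} → (∀ x → S x ≡ S′ x) → countFin S ≡ countFin S′
count-cong {S = S} {S′} S≗S′ =
  trans (countFin≡sum S) (trans (sum-cong-≗ (cong χ ∘ S≗S′)) (sym (countFin≡sum S′)))

count-mono : ∀ {n} {S S′ : Fin n → Bool} → (∀ x → T (S x) → T (S′ x)) → countFin S ≤ countFin S′
count-mono {S = S} {S′} S⊆S′ =
  subst₂ _≤_ (sym (countFin≡∑∈ S)) (sym (countFin≡∑∈ S′)) (∑∈-mono (λ _ → 1) S⊆S′)

count-union≤ : ∀ {n k} (R : Fin k → Fin n → Bool) →
  countFin (λ x → anyFin λ c → R c x) ≤ sum (λ c → countFin (R c))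
count-union≤ R = subst₂ _≤_ (sym (countFin≡∑∈ (λ x → anyFin λ c → R c x))) (sum-cong-≗ (λ c → sym (countFin≡∑∈ (R c))))
                        (∑∈-union≤ R (λ _ → 1))

count-union≡ : ∀ {n k} (R : Fin k → Fin n → Bool) → (∀ x c d → T (R c x) → T (R d x) → c ≡ d) →
  countFin (λ x → anyFin λ c → R c x) ≡ sum (λ c → countFin (R c))
count-union≡ R disjoint = trans (countFin≡∑∈ (λ x → anyFin λ c → R c x))
  (trans (∑∈-union≡ R (λ _ → 1) disjoint) (sum-cong-≗ (λ c → sym (countFin≡∑∈ (R c)))))

count-∧ : ∀ {n} b (S : Fin n → Bool) → countFin (λ x → b ∧ S x) ≡ χ b * countFin S
count-∧ b S = trans (countFin≡∑∈ (λ x → b ∧ S x))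
  (trans (∑∈-∧ b S (λ _ → 1)) (cong (χ b *_) (sym (countFin≡∑∈ S))))

count-single : ∀ {n} (u : Fin n) → countFin (λ x → ⌊ u ≟ x ⌋) ≡ 1
count-single u = trans (countFin≡∑∈ (λ x → ⌊ u ≟ x ⌋)) (∑∈-single u (λ _ → 1))

count-split : ∀ {n} (S g : Fin n → Bool) →
  countFin S ≡ countFin (λ x → S x ∧ g x) + countFin (λ x → S x ∧ not (g x))
count-split S g = trans (countFin≡∑∈ S)
  (trans (∑∈-split S g (λ _ → 1)) (sym (cong₂ _+_ (countFin≡∑∈ (λ x → S x ∧ g x)) (countFin≡∑∈ (λ x → S x ∧ not (g x))))))

count-witness : ∀ {n} (S : Fin n → Bool) → 1 ≤ countFin S → ∃ λ x → T (S x)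
count-witness S pos = ∑∈-witness S (λ _ → 1) (subst (1 ≤_) (countFin≡∑∈ S) pos)

count-∨ : ∀ {n} (S S′ : Fin n → Bool) →
  countFin (λ x → S x ∨ S′ x) ≤ countFin S + countFin S′
count-∨ S S′ = begin
  countFin (λ x → S x ∨ S′ x)           ≡⟨ countFin≡sum (λ x → S x ∨ S′ x) ⟩
  sum (λ x → χ (S x ∨ S′ x))            ≤⟨ sum-mono (λ x → χ-∨ (S x) (S′ x)) ⟩
  sum (λ x → χ (S x) + χ (S′ x))        ≡⟨ ∑-distrib-+ (χ ∘ S) (χ ∘ S′) ⟩
  sum (χ ∘ S) + sum (χ ∘ S′)            ≡⟨ sym (cong₂ _+_ (countFin≡sum S) (countFin≡sum S′)) ⟩
  countFin S + countFin S′              ∎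
  where open ≤-Reasoning

count-member : ∀ {n} (S : Fin n → Bool) x → T (S x) → 1 ≤ countFin S
count-member S x Sₓ = subst (_≤ countFin S) (count-single x)
  (count-mono {S = λ y → ⌊ x ≟ y ⌋} {S′ = S} λ y x≡y → subst (T ∘ S) (toWitness x≡y) Sₓ)

count-two : ∀ {n} (S : Fin n → Bool) i j → i ≢ j → T (S i) → T (S j) → 2 ≤ countFin S
count-two S i j i≢j Sᵢ Sⱼ = begin
  2                                               ≡⟨ sym (cong₂ _+_ (count-single i) (count-single j)) ⟩
  countFin (λ x → ⌊ i ≟ x ⌋) + countFin (λ x → ⌊ j ≟ x ⌋) ≡⟨ cong₂ _+_ (countFin≡sum (λ x → ⌊ i ≟ x ⌋)) (countFin≡sum (λ x → ⌊ j ≟ x ⌋)) ⟩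
  sum (λ x → χ ⌊ i ≟ x ⌋) + sum (λ x → χ ⌊ j ≟ x ⌋)    ≡⟨ sym (∑-distrib-+ (λ x → χ ⌊ i ≟ x ⌋) (λ x → χ ⌊ j ≟ x ⌋)) ⟩
  sum (λ x → χ ⌊ i ≟ x ⌋ + χ ⌊ j ≟ x ⌋)               ≤⟨ sum-mono pointwise ⟩
  sum (χ ∘ S)                                     ≡⟨ sym (countFin≡sum S) ⟩
  countFin S                                      ∎
  where
  open ≤-Reasoning
  pointwise : ∀ x → χ ⌊ i ≟ x ⌋ + χ ⌊ j ≟ x ⌋ ≤ χ (S x)
  pointwise x with i ≟ x | j ≟ x
  ... | yes refl | yes refl = ⊥-elim (i≢j refl)
  ... | yes refl | no _     = ≤-reflexive (sym (χ-true Sᵢ))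
  ... | no _     | yes refl = ≤-reflexive (sym (χ-true Sⱼ))
  ... | no _     | no _     = z≤n

image : ∀ {m n} → (Fin m → Fin n) → (Fin m → Bool) → Fin n → Bool
image φ p x = anyFin λ i → ⌊ φ i ≟ x ⌋ ∧ p i

count-image : ∀ {m n} (φ : Fin m → Fin n) → Injective φ → (p : Fin m → Bool) →
  countFin (image φ p) ≡ countFin p
count-image φ φ-inj p = begin
  countFin (image φ p)                                  ≡⟨ count-union≡ (λ i x → ⌊ φ i ≟ x ⌋ ∧ p i) disjoint ⟩
  sum (λ i → countFin (λ x → ⌊ φ i ≟ x ⌋ ∧ p i))        ≡⟨ sum-cong-≗ point ⟩
  sum (λ i → χ (p i) * 1)                               ≡⟨ sym (countFin≡∑∈ p) ⟩
  countFin p                                            ∎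
  where
  open ≡-Reasoning
  disjoint : ∀ x i j → T (⌊ φ i ≟ x ⌋ ∧ p i) → T (⌊ φ j ≟ x ⌋ ∧ p j) → i ≡ j
  disjoint x i j tᵢ tⱼ = φ-inj i j (trans (toWitness (∧-fst {⌊ φ i ≟ x ⌋} tᵢ)) (sym (toWitness (∧-fst {⌊ φ j ≟ x ⌋} tⱼ))))
  point : ∀ i → countFin (λ x → ⌊ φ i ≟ x ⌋ ∧ p i) ≡ χ (p i) * 1
  point i = begin
    countFin (λ x → ⌊ φ i ≟ x ⌋ ∧ p i)  ≡⟨ count-cong (λ x → ∧-comm ⌊ φ i ≟ x ⌋ (p i)) ⟩
    countFin (λ x → p i ∧ ⌊ φ i ≟ x ⌋)  ≡⟨ count-∧ (p i) (λ x → ⌊ φ i ≟ x ⌋) ⟩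
    χ (p i) * countFin (λ x → ⌊ φ i ≟ x ⌋) ≡⟨ cong (χ (p i) *_) (count-single (φ i)) ⟩
    χ (p i) * 1                         ∎
    where open ≡-Reasoning

before : ∀ {n} → Fin n → Fin n → ℕ
before x y = χ (toℕ x <ᵇ toℕ y)

countPairs≡ : ∀ {n} (r : Fin n → Fin n → Bool) →
  countPairs r ≡ sum (λ x → ∑[ y ∈ r x ] before x y)
countPairs≡ r = trans (sumFin≡sum (λ x → countFin (λ y → (toℕ x <ᵇ toℕ y) ∧ r x y))) (sum-cong-≗ row)
  where
  row : ∀ x → countFin (λ y → (toℕ x <ᵇ toℕ y) ∧ r x y) ≡ ∑[ y ∈ r x ] before x y
  row x = trans (countFin≡sum (λ y → (toℕ x <ᵇ toℕ y) ∧ r x y))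
                (sum-cong-≗ λ y → trans (χ-∧ (toℕ x <ᵇ toℕ y) (r x y)) (*-comm (before x y) _))

pairs-cong : ∀ {n} {r r′ : Fin n → Fin n → Bool} → (∀ x y → r x y ≡ r′ x y) →
  countPairs r ≡ countPairs r′
pairs-cong {r = r} {r′} r≗r′ = trans (countPairs≡ r)
  (trans (sum-cong-≗ λ x → ∑∈-cong (before x) (r≗r′ x)) (sym (countPairs≡ r′)))

pairs-mono : ∀ {n} {r r′ : Fin n → Fin n → Bool} → (∀ x y → T (r x y) → T (r′ x y)) →
  countPairs r ≤ countPairs r′
pairs-mono {r = r} {r′} r⊆r′ = subst₂ _≤_ (sym (countPairs≡ r)) (sym (countPairs≡ r′))
  (sum-mono λ x → ∑∈-mono (before x) (r⊆r′ x))

pairs-∧ : ∀ {n} b (r : Fin n → Fin n → Bool) → countPairs (λ x y → b ∧ r x y) ≡ χ b * countPairs r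
pairs-∧ b r = begin
  countPairs (λ x y → b ∧ r x y)                        ≡⟨ countPairs≡ (λ x y → b ∧ r x y) ⟩
  sum (λ x → ∑[ y ∈ (λ y → b ∧ r x y) ] before x y)     ≡⟨ sum-cong-≗ (λ x → ∑∈-∧ b (r x) (before x)) ⟩
  sum (λ x → χ b * ∑[ y ∈ r x ] before x y)             ≡⟨ sym (*-distribˡ-sum (χ b) (λ x → ∑[ y ∈ r x ] before x y)) ⟩
  χ b * sum (λ x → ∑[ y ∈ r x ] before x y)             ≡⟨ cong (χ b *_) (sym (countPairs≡ r)) ⟩
  χ b * countPairs r                                    ∎
  where open ≡-Reasoning

pairs-union≤ : ∀ {n k} (R : Fin k → Fin n → Fin n → Bool) →
  countPairs (λ x y → anyFin λ c → R c x y) ≤ sum (λ c → countPairs (R c))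
pairs-union≤ R = begin
  countPairs (λ x y → anyFin λ c → R c x y)                        ≡⟨ countPairs≡ (λ x y → anyFin λ c → R c x y) ⟩
  sum (λ x → ∑[ y ∈ (λ y → anyFin λ c → R c x y) ] before x y)     ≤⟨ sum-mono (λ x → ∑∈-union≤ (λ c → R c x) (before x)) ⟩
  sum (λ x → sum (λ c → ∑[ y ∈ R c x ] before x y))                ≡⟨ ∑-comm (λ x c → ∑[ y ∈ R c x ] before x y) ⟩
  sum (λ c → sum (λ x → ∑[ y ∈ R c x ] before x y))                ≡⟨ sum-cong-≗ (λ c → sym (countPairs≡ (R c))) ⟩
  sum (λ c → countPairs (R c))                                     ∎
  where open ≤-Reasoning

pairs-union≡ : ∀ {n k} (R : Fin k → Fin n → Fin n → Bool) →
  (∀ x y c d → T (R c x y) → T (R d x y) → c ≡ d) →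
  countPairs (λ x y → anyFin λ c → R c x y) ≡ sum (λ c → countPairs (R c))
pairs-union≡ R disjoint = begin
  countPairs (λ x y → anyFin λ c → R c x y)                        ≡⟨ countPairs≡ (λ x y → anyFin λ c → R c x y) ⟩
  sum (λ x → ∑[ y ∈ (λ y → anyFin λ c → R c x y) ] before x y)     ≡⟨ sum-cong-≗ (λ x → ∑∈-union≡ (λ c → R c x) (before x) (disjoint x)) ⟩
  sum (λ x → sum (λ c → ∑[ y ∈ R c x ] before x y))                ≡⟨ ∑-comm (λ x c → ∑[ y ∈ R c x ] before x y) ⟩
  sum (λ c → sum (λ x → ∑[ y ∈ R c x ] before x y))                ≡⟨ sum-cong-≗ (λ c → sym (countPairs≡ (R c))) ⟩
  sum (λ c → countPairs (R c))                                     ∎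
  where open ≡-Reasoning

pairs-single : ∀ {n} (u v : Fin n) b →
  countPairs (λ x y → ⌊ u ≟ x ⌋ ∧ ⌊ v ≟ y ⌋ ∧ b) ≡ χ b * before u v
pairs-single u v b = begin
  countPairs (λ x y → ⌊ u ≟ x ⌋ ∧ ⌊ v ≟ y ⌋ ∧ b)                  ≡⟨ countPairs≡ (λ x y → ⌊ u ≟ x ⌋ ∧ ⌊ v ≟ y ⌋ ∧ b) ⟩
  sum (λ x → ∑[ y ∈ (λ y → ⌊ u ≟ x ⌋ ∧ ⌊ v ≟ y ⌋ ∧ b) ] before x y) ≡⟨ sum-cong-≗ (λ x → ∑∈-∧ ⌊ u ≟ x ⌋ (λ y → ⌊ v ≟ y ⌋ ∧ b) (before x)) ⟩
  ∑[ x ∈ (λ x → ⌊ u ≟ x ⌋) ] ∑[ y ∈ (λ y → ⌊ v ≟ y ⌋ ∧ b) ] before x y ≡⟨ sum-cong-≗ (λ x → cong (χ ⌊ u ≟ x ⌋ *_) (column x)) ⟩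
  ∑[ x ∈ (λ x → ⌊ u ≟ x ⌋) ] (χ b * before x v)                     ≡⟨ ∑∈-single u (λ x → χ b * before x v) ⟩
  χ b * before u v                                                 ∎
  where
  open ≡-Reasoning
  column : ∀ x → ∑[ y ∈ (λ y → ⌊ v ≟ y ⌋ ∧ b) ] before x y ≡ χ b * before x v
  column x = begin
    ∑[ y ∈ (λ y → ⌊ v ≟ y ⌋ ∧ b) ] before x y  ≡⟨ ∑∈-cong (before x) (λ y → ∧-comm ⌊ v ≟ y ⌋ b) ⟩
    ∑[ y ∈ (λ y → b ∧ ⌊ v ≟ y ⌋) ] before x y  ≡⟨ ∑∈-∧ b (λ y → ⌊ v ≟ y ⌋) (before x) ⟩
    χ b * ∑[ y ∈ (λ y → ⌊ v ≟ y ⌋) ] before x y ≡⟨ cong (χ b *_) (∑∈-single v (before x)) ⟩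
    χ b * before x v                           ∎

before-both≢ : ∀ {n} {x y : Fin n} → x ≢ y → before x y + before y x ≡ 1
before-both≢ {x = x} {y} x≢y with <-cmp (toℕ x) (toℕ y)
... | tri< x<y _ y≮x = cong₂ _+_ (χ-true (<⇒<ᵇ x<y)) (χ-false (y≮x ∘ <ᵇ⇒< _ _))
... | tri≈ _ x≡y _   = ⊥-elim (x≢y (toℕ-injective x≡y))
... | tri> x≮y _ y<x = cong₂ _+_ (χ-false (x≮y ∘ <ᵇ⇒< _ _)) (χ-true (<⇒<ᵇ y<x))

before-both≡ : ∀ {n} (x : Fin n) → before x x + before x x ≡ 0
before-both≡ x = cong₂ _+_ irrefl irrefl
  where
  irrefl : before x x ≡ 0
  irrefl = χ-false (<-irrefl refl ∘ <ᵇ⇒< (toℕ x) (toℕ x))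

double-injective : ∀ {a b} → a + a ≡ b + b → a ≡ b
double-injective {a} {b} eq = *-cancelˡ-≡ a b 2
  (trans (cong (a +_) (+-identityʳ a)) (trans eq (cong (b +_) (sym (+-identityʳ b)))))

sum-symmetrised : ∀ {m} (w p q : Fin m → Fin m → ℕ) → (∀ i j → w i j ≡ w j i) →
  (∀ i j → p i j + p j i ≡ q i j + q j i) →
  sum (λ i → sum (λ j → w i j * p i j)) ≡ sum (λ i → sum (λ j → w i j * q i j))
sum-symmetrised {m} w p q w-sym p≈q = double-injective (begin
  D p + D p   ≡⟨ doubled p ⟩
  sum (λ i → sum (λ j → w i j * (p i j + p j i)))  ≡⟨ sum-cong-≗ (λ i → sum-cong-≗ λ j → cong (w i j *_) (p≈q i j)) ⟩
  sum (λ i → sum (λ j → w i j * (q i j + q j i)))  ≡⟨ sym (doubled q) ⟩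
  D q + D q   ∎)
  where
  open ≡-Reasoning
  D : (Fin m → Fin m → ℕ) → ℕ
  D p = sum (λ i → sum (λ j → w i j * p i j))
  transposed : ∀ p → D p ≡ sum (λ i → sum (λ j → w i j * p j i))
  transposed p = trans (∑-comm (λ i j → w i j * p i j))
                       (sum-cong-≗ λ i → sum-cong-≗ λ j → cong (_* p j i) (w-sym j i))
  doubled : ∀ p → D p + D p ≡ sum (λ i → sum (λ j → w i j * (p i j + p j i)))
  doubled p = begin
    D p + D p                                                   ≡⟨ cong (D p +_) (transposed p) ⟩
    D p + sum (λ i → sum (λ j → w i j * p j i))                 ≡⟨ sym (∑-distrib-+ (λ i → sum (λ j → w i j * p i j)) (λ i → sum (λ j → w i j * p j i))) ⟩
    sum (λ i → sum (λ j → w i j * p i j) + sum (λ j → w i j * p j i)) ≡⟨ sum-cong-≗ (λ i → sym (∑-distrib-+ (λ j → w i j * p i j) (λ j → w i j * p j i))) ⟩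
    sum (λ i → sum (λ j → w i j * p i j + w i j * p j i))       ≡⟨ sum-cong-≗ (λ i → sum-cong-≗ λ j → sym (*-distribˡ-+ (w i j) (p i j) (p j i))) ⟩
    sum (λ i → sum (λ j → w i j * (p i j + p j i)))             ∎

imageRel : ∀ {m n} → (Fin m → Fin n) → (Fin m → Fin m → Bool) → Fin n → Fin n → Bool
imageRel φ r x y = anyFin λ i → anyFin λ j → ⌊ φ i ≟ x ⌋ ∧ ⌊ φ j ≟ y ⌋ ∧ r i j

pairs-image : ∀ {m n} (φ : Fin m → Fin n) → Injective φ → (r : Fin m → Fin m → Bool) →
  (∀ i j → r i j ≡ r j i) → countPairs (imageRel φ r) ≡ countPairs r
pairs-image {m} {n} φ φ-inj r r-sym = begin
  countPairs (imageRel φ r)                                             ≡⟨ pairs-union≡ (λ i x y → anyFin λ j → point i j x y) disjointᵢ ⟩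
  sum (λ i → countPairs (λ x y → anyFin λ j → point i j x y))           ≡⟨ sum-cong-≗ (λ i → pairs-union≡ (point i) (disjointⱼ i)) ⟩
  sum (λ i → sum (λ j → countPairs (point i j)))                        ≡⟨ sum-cong-≗ (λ i → sum-cong-≗ λ j → pairs-single (φ i) (φ j) (r i j)) ⟩
  sum (λ i → sum (λ j → χ (r i j) * before (φ i) (φ j)))                ≡⟨ sum-symmetrised (λ i j → χ (r i j)) (λ i j → before (φ i) (φ j)) before (λ i j → cong χ (r-sym i j)) reorient ⟩
  sum (λ i → ∑[ j ∈ r i ] before i j)                                   ≡⟨ sym (countPairs≡ r) ⟩
  countPairs r                                                          ∎
  where
  open ≡-Reasoning
  point : Fin m → Fin m → Fin n → Fin n → Bool
  point i j x y = ⌊ φ i ≟ x ⌋ ∧ ⌊ φ j ≟ y ⌋ ∧ r i j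
  source : ∀ {i j x y} → T (point i j x y) → φ i ≡ x × φ j ≡ y
  source {i} {j} {x} {y} t =
    toWitness (∧-fst {⌊ φ i ≟ x ⌋} t) , toWitness (∧-fst {⌊ φ j ≟ y ⌋} (∧-snd {⌊ φ i ≟ x ⌋} t))
  disjointᵢ : ∀ x y i i′ → T (anyFin λ j → point i j x y) → T (anyFin λ j → point i′ j x y) → i ≡ i′
  disjointᵢ x y i i′ t t′ =
    let j , tⱼ = any-witness (λ j → point i j x y) t
        j′ , t′ⱼ = any-witness (λ j → point i′ j x y) t′
    in φ-inj i i′ (trans (proj₁ (source {i} {j} tⱼ)) (sym (proj₁ (source {i′} {j′} t′ⱼ))))
  disjointⱼ : ∀ i x y j j′ → T (point i j x y) → T (point i j′ x y) → j ≡ j′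
  disjointⱼ i x y j j′ t t′ = φ-inj j j′ (trans (proj₂ (source {i} {j} t)) (sym (proj₂ (source {i} {j′} t′))))
  reorient : ∀ i j → before (φ i) (φ j) + before (φ j) (φ i) ≡ before i j + before j i
  reorient i j with i ≟ j
  ... | yes refl = trans (before-both≡ (φ i)) (sym (before-both≡ i))
  ... | no i≢j   = trans (before-both≢ (i≢j ∘ φ-inj i j)) (sym (before-both≢ i≢j))

pairs-ordered : ∀ {n} (r : Fin n → Fin n → Bool) a b → before a b ≡ 1 → T (r a b) →
  1 ≤ countPairs r
pairs-ordered r a b a<b rₐᵦ = begin
  1                                    ≡⟨ sym (cong₂ _*_ (χ-true rₐᵦ) a<b) ⟩
  χ (r a b) * before a b               ≤⟨ sum-term (λ y → χ (r a y) * before a y) b ⟩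
  ∑[ y ∈ r a ] before a y              ≤⟨ sum-term (λ x → ∑[ y ∈ r x ] before x y) a ⟩
  sum (λ x → ∑[ y ∈ r x ] before x y)  ≡⟨ sym (countPairs≡ r) ⟩
  countPairs r                         ∎
  where open ≤-Reasoning

pairs-edge : ∀ {n} (r : Fin n → Fin n → Bool) → (∀ i j → r i j ≡ r j i) →
  ∀ i j → i ≢ j → T (r i j) → 1 ≤ countPairs r
pairs-edge r r-sym i j i≢j rᵢⱼ with toℕ i <ᵇ toℕ j in ord
... | true  = pairs-ordered r i j (χ-true (subst T (sym ord) tt)) rᵢⱼ
... | false = pairs-ordered r j i j<i (subst T (r-sym i j) rᵢⱼ)
  where
  j<i : before j i ≡ 1
  j<i = trans (cong (λ b → χ b + before j i) (sym ord)) (before-both≢ i≢j)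

pairs-witness : ∀ {n} (r : Fin n → Fin n → Bool) → 1 ≤ countPairs r →
  ∃ λ i → ∃ λ j → i ≢ j × T (r i j)
pairs-witness r pos
  with sum-pos (λ x → countFin (λ y → (toℕ x <ᵇ toℕ y) ∧ r x y))
               (subst (1 ≤_) (sumFin≡sum (λ x → countFin (λ y → (toℕ x <ᵇ toℕ y) ∧ r x y))) pos)
... | x , posₓ with count-witness (λ y → (toℕ x <ᵇ toℕ y) ∧ r x y) posₓ
...   | y , t = x , y , x≢y , ∧-snd {toℕ x <ᵇ toℕ y} t
  where
  x≢y : x ≢ y
  x≢y refl = <-irrefl refl (<ᵇ⇒< (toℕ x) (toℕ x) (∧-fst {toℕ x <ᵇ toℕ x} t))

≟-refl : ∀ {n} (x : Fin n) → T ⌊ x ≟ x ⌋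
≟-refl x = fromWitness refl

image-intro : ∀ {m n} (φ : Fin m → Fin n) (p : Fin m → Bool) i → T (p i) → T (image φ p (φ i))
image-intro φ p i pᵢ = any-intro _ i (∧-intro (≟-refl (φ i)) pᵢ)

image-witness : ∀ {m n} (φ : Fin m → Fin n) (p : Fin m → Bool) x → T (image φ p x) →
  ∃ λ i → φ i ≡ x × T (p i)
image-witness φ p x t with any-witness (λ i → ⌊ φ i ≟ x ⌋ ∧ p i) t
... | i , tᵢ = i , toWitness (∧-fst {⌊ φ i ≟ x ⌋} tᵢ) , ∧-snd {⌊ φ i ≟ x ⌋} tᵢ

imageRel-intro : ∀ {m n} (φ : Fin m → Fin n) (r : Fin m → Fin m → Bool) i j →
  T (r i j) → T (imageRel φ r (φ i) (φ j))
imageRel-intro φ r i j rᵢⱼ =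
  any-intro _ i (any-intro _ j (∧-intro (≟-refl (φ i)) (∧-intro (≟-refl (φ j)) rᵢⱼ)))

imageRel-witness : ∀ {m n} (φ : Fin m → Fin n) (r : Fin m → Fin m → Bool) x y →
  T (imageRel φ r x y) → ∃ λ i → ∃ λ j → φ i ≡ x × φ j ≡ y × T (r i j)
imageRel-witness φ r x y t with any-witness _ t
... | i , tᵢ with any-witness (λ j → ⌊ φ i ≟ x ⌋ ∧ ⌊ φ j ≟ y ⌋ ∧ r i j) tᵢ
...   | j , tᵢⱼ = i , j , toWitness (∧-fst {⌊ φ i ≟ x ⌋} tᵢⱼ) ,
                 toWitness (∧-fst {⌊ φ j ≟ y ⌋} rest) , ∧-snd {⌊ φ j ≟ y ⌋} rest
  where
  rest : T (⌊ φ j ≟ y ⌋ ∧ r i j)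
  rest = ∧-snd {⌊ φ i ≟ x ⌋} tᵢⱼ

imageRel-sym : ∀ {m n} (φ : Fin m → Fin n) (r : Fin m → Fin m → Bool) →
  (∀ i j → r i j ≡ r j i) → ∀ x y → imageRel φ r x y ≡ imageRel φ r y x
imageRel-sym φ r r-sym x y = T-ext (flip x y) (flip y x)
  where
  flip : ∀ x y → T (imageRel φ r x y) → T (imageRel φ r y x)
  flip x y t with imageRel-witness φ r x y t
  ... | i , j , refl , refl , rᵢⱼ = imageRel-intro φ r j i (subst T (r-sym i j) rᵢⱼ)

adj-distinct : (G : Graph) → ∀ i j → T (adj G i j) → i ≢ j
adj-distinct G i .i t refl = subst T (irr G i) t

sub-vertices≥2 : ∀ {G} (S : Sub G) → 1 ≤ eSub S → 2 ≤ vSub S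
sub-vertices≥2 S pos with pairs-witness (es S) pos
... | i , j , i≢j , t = count-two (vs S) i j i≢j (es-end S i j t) (es-end S j i (subst T (es-sym S i j) t))

graph-vertices≥2 : (G : Graph) → 1 ≤ eG G → 2 ≤ vG G
graph-vertices≥2 G pos with pairs-witness (adj G) pos
... | i , j , i≢j , _ = subst (2 ≤_) (count-all (n G)) (count-two (λ _ → true) i j i≢j tt tt)

module _ (Tg : Graph) {N : ℕ} (φ : Fin (n Tg) → Fin N) where

  copyVert-intro : ∀ i → T (copyVert Tg φ (φ i))
  copyVert-intro i = any-intro _ i (≟-refl (φ i))

  copyEdge-witness : ∀ x y → T (copyEdge Tg φ x y) →
    ∃ λ i → ∃ λ j → φ i ≡ x × φ j ≡ y × T (adj Tg i j)
  copyEdge-witness = imageRel-witness φ (adj Tg)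

  copyEdge-ends : ∀ x y → T (copyEdge Tg φ x y) → T (copyVert Tg φ x) × T (copyVert Tg φ y)
  copyEdge-ends x y t with copyEdge-witness x y t
  ... | i , j , refl , refl , _ = copyVert-intro i , copyVert-intro j

  copyVert-∧ : ∀ (g : Fin N → Bool) x → copyVert Tg φ x ∧ g x ≡ image φ (g ∘ φ) x
  copyVert-∧ g x = T-ext into back
    where
    into : T (copyVert Tg φ x ∧ g x) → T (image φ (g ∘ φ) x)
    into t with any-witness (λ i → ⌊ φ i ≟ x ⌋) (∧-fst {copyVert Tg φ x} t)
    ... | i , tᵢ with toWitness tᵢ
    ...   | refl = image-intro φ (g ∘ φ) i (∧-snd {copyVert Tg φ x} t)
    back : T (image φ (g ∘ φ) x) → T (copyVert Tg φ x ∧ g x)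
    back t with image-witness φ (g ∘ φ) x t
    ... | i , refl , gᵢ = ∧-intro (copyVert-intro i) gᵢ

  copyEdge-∧ : ∀ (E : Fin N → Fin N → Bool) x y →
    copyEdge Tg φ x y ∧ E x y ≡ imageRel φ (λ i j → adj Tg i j ∧ E (φ i) (φ j)) x y
  copyEdge-∧ E x y = T-ext into back
    where
    into : T (copyEdge Tg φ x y ∧ E x y) → T (imageRel φ (λ i j → adj Tg i j ∧ E (φ i) (φ j)) x y)
    into t with copyEdge-witness x y (∧-fst {copyEdge Tg φ x y} t)
    ... | i , j , refl , refl , aᵢⱼ =
      imageRel-intro φ _ i j (∧-intro aᵢⱼ (∧-snd {copyEdge Tg φ (φ i) (φ j)} t))
    back : T (imageRel φ (λ i j → adj Tg i j ∧ E (φ i) (φ j)) x y) → T (copyEdge Tg φ x y ∧ E x y)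
    back t with imageRel-witness φ _ x y t
    ... | i , j , refl , refl , tᵢⱼ =
      ∧-intro (imageRel-intro φ (adj Tg) i j (∧-fst {adj Tg i j} tᵢⱼ)) (∧-snd {adj Tg i j} tᵢⱼ)

  module _ (φ-inj : Injective φ) where

    copy-vertices-in : ∀ (g : Fin N → Bool) → countFin (λ x → copyVert Tg φ x ∧ g x) ≡ countFin (g ∘ φ)
    copy-vertices-in g = trans (count-cong (copyVert-∧ g)) (count-image φ φ-inj (g ∘ φ))

    copy-vertices : countFin (copyVert Tg φ) ≡ vG Tg
    copy-vertices = begin
      countFin (copyVert Tg φ)                        ≡⟨ count-cong (λ x → sym (∧-identityʳ (copyVert Tg φ x))) ⟩
      countFin (λ x → copyVert Tg φ x ∧ true)         ≡⟨ copy-vertices-in (λ _ → true) ⟩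
      countFin {n Tg} (λ _ → true)                    ≡⟨ count-all (n Tg) ⟩
      vG Tg                                           ∎
      where open ≡-Reasoning

    copy-edges : countPairs (copyEdge Tg φ) ≡ eG Tg
    copy-edges = pairs-image φ φ-inj (adj Tg) (adj-sym Tg)

    copy-edges-in : ∀ (E : Fin N → Fin N → Bool) → (∀ x y → E x y ≡ E y x) →
      countPairs (λ x y → copyEdge Tg φ x y ∧ E x y) ≡ countPairs (λ i j → adj Tg i j ∧ E (φ i) (φ j))
    copy-edges-in E E-sym = trans (pairs-cong (copyEdge-∧ E))
      (pairs-image φ φ-inj _ λ i j → cong₂ _∧_ (adj-sym Tg i j) (E-sym (φ i) (φ j)))

module _ {Tg : Graph} (F : Collection Tg) where

  selected-copy-edges : ∀ S →
    sum (λ c → countPairs (λ x y → S c ∧ copyEdge Tg (cp F c) x y)) ≡ countFin S * eG Tg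
  selected-copy-edges S = trans
    (sum-cong-≗ λ c → trans (pairs-∧ (S c) (copyEdge Tg (cp F c)))
                            (cong (χ (S c) *_) (copy-edges Tg (cp F c) (cpInj F c))))
    (∑∈-const S (eG Tg))

  union-edges≤ : ∀ S → eU F S ≤ countFin S * eG Tg
  union-edges≤ S = ≤-trans (pairs-union≤ (λ c x y → S c ∧ copyEdge Tg (cp F c) x y))
                           (≤-reflexive (selected-copy-edges S))

  union-edges≡ : EdgeDisjoint F → ∀ S → eU F S ≡ countFin S * eG Tg
  union-edges≡ disjoint S = trans (pairs-union≡ (λ c x y → S c ∧ copyEdge Tg (cp F c) x y) distinct)
                                  (selected-copy-edges S)
    where
    distinct : ∀ x y c d → T (S c ∧ copyEdge Tg (cp F c) x y) → T (S d ∧ copyEdge Tg (cp F d) x y) → c ≡ d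
    distinct x y c d t t′ with c ≟ d
    ... | yes c≡d = c≡d
    ... | no c≢d  = ⊥-elim (disjoint c d c≢d x y (∧-snd {S c} t) (∧-snd {S d} t′))

  union-vertices≥ : ∀ S c → T (S c) → vG Tg ≤ vU F S
  union-vertices≥ S c S-c = subst (_≤ vU F S) (copy-vertices Tg (cp F c) (cpInj F c))
    (count-mono {S = copyVert Tg (cp F c)} {S′ = UVert F S}
      λ x t → any-intro (λ d → S d ∧ copyVert Tg (cp F d) x) c (∧-intro S-c t))

-- A 2-balanced graph bounds the density of each of its subgraphs J with an
-- edge, including the single-edge case: with a = v_T − 2 and b = e_T − 1,
-- a e_J + 2b ≤ b v_J + a, i.e. (e_J − 1) a ≤ b (v_J − 2).
balanced-sub : ∀ {G} → TwoBalanced G → (J : Sub G) → 1 ≤ eSub J →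
  (vG G ∸ 2) * eSub J + 2 * (eG G ∸ 1) ≤ (eG G ∸ 1) * vSub J + (vG G ∸ 2)
balanced-sub {G} (_ , balanced) J eJ≥1
  with m≤n⇒∃[o]m+o≡n eJ≥1 | m≤n⇒∃[o]m+o≡n (sub-vertices≥2 J eJ≥1)
... | f , eJ≡ | w , vJ≡ = subst₂ (λ e v → a * e + 2 * b ≤ b * v + a) eJ≡ vJ≡
  (subst₂ _≤_ (sym (lhs a b f)) (sym (rhs a b w)) (+-monoˡ-≤ (a + 2 * b) (density f eJ≡)))
  where
  a b : ℕ
  a = vG G ∸ 2
  b = eG G ∸ 1
  density : ∀ f → 1 + f ≡ eSub J → f * a ≤ b * w
  density zero    _  = z≤n
  density (suc f) eq = subst₂ (λ e v → (e ∸ 1) * a ≤ b * (v ∸ 2)) (sym eq) (sym vJ≡)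
                              (balanced J (subst (2 ≤_) eq (s≤s (s≤s z≤n))))
  lhs : ∀ a b f → a * (1 + f) + 2 * b ≡ f * a + (a + 2 * b)
  lhs = solve-∀
  rhs : ∀ a b w → b * (2 + w) + a ≡ b * w + (a + 2 * b)
  rhs = solve-∀

density-bound-≤ : ∀ {eT vT s e′ v′ eU vU} →
  1 ≤ eT → 2 ≤ vT → 1 ≤ s → 2 ≤ v′ → s ≤ e′ → vT ≤ vU →
  eU ≤ s * eT → v′ + s * (vT ∸ 2) ≤ vU →
  (e′ ∸ 1) * (vT ∸ 2) ≤ (eT ∸ 1) * (v′ ∸ 2) →
  (eU ∸ eT) * (vT ∸ 2) ≤ (eT ∸ 1) * (vU ∸ vT)
density-bound-≤ {eU = eU} eT≥1 vT≥2 s≥1 v′≥2 s≤e′ vT≤vU eU≤ vU≥ m₂H′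
  with m≤n⇒∃[o]m+o≡n eT≥1 | m≤n⇒∃[o]m+o≡n vT≥2 | m≤n⇒∃[o]m+o≡n s≥1
     | m≤n⇒∃[o]m+o≡n v′≥2 | m≤n⇒∃[o]m+o≡n s≤e′ | m≤n⇒∃[o]m+o≡n vT≤vU
... | b , refl | a , refl | t , refl | w , refl | g , refl | d , refl = begin
  (eU ∸ (1 + b)) * a       ≤⟨ *-monoˡ-≤ a (m≤n+o⇒m∸n≤o eU (1 + b) eU≤) ⟩
  t * (1 + b) * a          ≡⟨ expand t b a ⟩
  t * a + b * (t * a)      ≤⟨ +-monoˡ-≤ (b * (t * a)) (*-monoˡ-≤ a (m≤m+n t g)) ⟩
  (t + g) * a + b * (t * a) ≤⟨ +-monoˡ-≤ (b * (t * a)) m₂H′ ⟩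
  b * w + b * (t * a)      ≡⟨ sym (*-distribˡ-+ b w (t * a)) ⟩
  b * (w + t * a)          ≤⟨ *-monoʳ-≤ b new-vertices ⟩
  b * d                    ≡⟨ cong (b *_) (sym (m+n∸m≡n (2 + a) d)) ⟩
  b * (2 + a + d ∸ (2 + a)) ∎
  where
  open ≤-Reasoning
  expand : ∀ t b a → t * (1 + b) * a ≡ t * a + b * (t * a)
  expand = solve-∀
  regroup : ∀ w t a → (2 + w) + (1 + t) * a ≡ (2 + a) + (w + t * a)
  regroup = solve-∀
  -- the union has w + t a vertices beyond those of one copy
  new-vertices : w + t * a ≤ d
  new-vertices = +-cancelˡ-≤ (2 + a) _ _ (subst (_≤ 2 + a + d) (regroup w t a) vU≥)

density-bound-> : ∀ {eT vT s e′ v′ eU vU EJ VJ} →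
  1 ≤ eT → 2 ≤ vT → 1 ≤ s → 2 ≤ v′ → 1 ≤ e′ → vT ≤ vU → e′ ≤ EJ →
  eU ≡ s * eT → vU + VJ ≤ v′ + s * vT →
  (vT ∸ 2) * EJ + s * (2 * (eT ∸ 1)) ≤ (eT ∸ 1) * VJ + s * (vT ∸ 2) →
  (eT ∸ 1) * (v′ ∸ 2) < (e′ ∸ 1) * (vT ∸ 2) →
  2 ≤ s × (eT ∸ 1) * (vU ∸ vT) < (eU ∸ eT) * (vT ∸ 2)
density-bound-> {VJ = VJ} eT≥1 vT≥2 s≥1 v′≥2 e′≥1 vT≤vU e′≤EJ refl vertices traces m₂H′
  with m≤n⇒∃[o]m+o≡n eT≥1 | m≤n⇒∃[o]m+o≡n vT≥2 | m≤n⇒∃[o]m+o≡n s≥1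
     | m≤n⇒∃[o]m+o≡n v′≥2 | m≤n⇒∃[o]m+o≡n e′≥1 | m≤n⇒∃[o]m+o≡n vT≤vU
     | m≤n⇒∃[o]m+o≡n e′≤EJ
... | b , refl | a , refl | t , refl | w , refl | f , refl | d , refl | g , refl =
  two-copies t key , subst₂ (λ x y → b * x < y * a) (sym (m+n∸m≡n (2 + a) d))
                            (sym (m+n∸m≡n (1 + b) (t * (1 + b)))) key
  where
  open ≤-Reasoning
  K : ℕ
  K = b * VJ + b * (2 + a) + a + 2 * b * (1 + t)
  -- b times the vertex count plus the trace bound, sorted into the
  -- quantities of interest and a common remainder K.
  combined : (b * d + a * f) + a * g + K ≤ (b * w + t * (1 + b) * a) + K
  combined = begin
    (b * d + a * f) + a * g + K                                    ≡⟨ lhs b a d VJ f g t ⟩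
    b * (2 + a + d + VJ) + (a * (1 + f + g) + (1 + t) * (2 * b))   ≤⟨ +-mono-≤ (*-monoʳ-≤ b vertices) traces ⟩
    b * (2 + w + (1 + t) * (2 + a)) + (b * VJ + (1 + t) * a)       ≡⟨ rhs b a w VJ t ⟩
    (b * w + t * (1 + b) * a) + K                                  ∎
    where
    lhs : ∀ b a d VJ f g t → (b * d + a * f) + a * g + (b * VJ + b * (2 + a) + a + 2 * b * (1 + t))
                        ≡ b * (2 + a + d + VJ) + (a * (1 + f + g) + (1 + t) * (2 * b))
    lhs = solve-∀
    rhs : ∀ b a w VJ t → b * (2 + w + (1 + t) * (2 + a)) + (b * VJ + (1 + t) * a)
                       ≡ (b * w + t * (1 + b) * a) + (b * VJ + b * (2 + a) + a + 2 * b * (1 + t))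
    rhs = solve-∀
  key : b * d < t * (1 + b) * a
  key = +-cancelʳ-< (a * f) (b * d) (t * (1 + b) * a) (begin-strict
    b * d + a * f                   ≤⟨ ≤-trans (m≤m+n _ (a * g)) (+-cancelʳ-≤ K _ _ combined) ⟩
    b * w + t * (1 + b) * a         <⟨ +-monoˡ-< (t * (1 + b) * a) m₂H′ ⟩
    f * a + t * (1 + b) * a         ≡⟨ cong₂ _+_ (*-comm f a) refl ⟩
    a * f + t * (1 + b) * a         ≡⟨ +-comm (a * f) _ ⟩
    t * (1 + b) * a + a * f         ∎)
  -- With a single copy the right-hand side of key vanishes.
  two-copies : ∀ t → b * d < t * (1 + b) * a → 2 ≤ 1 + t
  two-copies zero    ()
  two-copies (suc t) _ = s≤s (s≤s z≤n)

module PartI {H Tg : Graph} {F : Collection Tg} (fe : IsFe Tg H F) where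
  open IsFe fe

  end₁ end₂ : Fin (k F) → Fin (n H)
  end₁ c = proj₁ (ends c)
  end₂ c = proj₂ (ends c)

  isEdgeOf : Fin (k F) → Fin (n H) → Fin (n H) → Bool
  isEdgeOf c a b = (⌊ end₁ c ≟ a ⌋ ∧ ⌊ end₂ c ≟ b ⌋) ∨ (⌊ end₁ c ≟ b ⌋ ∧ ⌊ end₂ c ≟ a ⌋)

  isEdgeOf-sym : ∀ c a b → isEdgeOf c a b ≡ isEdgeOf c b a
  isEdgeOf-sym c a b = ∨-comm (⌊ end₁ c ≟ a ⌋ ∧ ⌊ end₂ c ≟ b ⌋) _

  isEdgeOf-cases : ∀ c a b → T (isEdgeOf c a b) →
    (end₁ c ≡ a × end₂ c ≡ b) ⊎ (end₁ c ≡ b × end₂ c ≡ a)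
  isEdgeOf-cases c a b t with ∨-elim {⌊ end₁ c ≟ a ⌋ ∧ ⌊ end₂ c ≟ b ⌋} t
  ... | inj₁ u = inj₁ (toWitness (∧-fst {⌊ end₁ c ≟ a ⌋} u) , toWitness (∧-snd {⌊ end₁ c ≟ a ⌋} u))
  ... | inj₂ u = inj₂ (toWitness (∧-fst {⌊ end₁ c ≟ b ⌋} u) , toWitness (∧-snd {⌊ end₁ c ≟ b ⌋} u))

  isEdgeOf-own : ∀ c → T (isEdgeOf c (end₁ c) (end₂ c))
  isEdgeOf-own c = ∨-inl (∧-intro (≟-refl (end₁ c)) (≟-refl (end₂ c)))

  -- Distinct copies carry distinct edges (the edges are listed in increasing order).
  isEdgeOf-unique : ∀ a b c d → T (isEdgeOf c a b) → T (isEdgeOf d a b) → c ≡ d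
  isEdgeOf-unique a b c d t t′ with isEdgeOf-cases c a b t | isEdgeOf-cases d a b t′
  ... | inj₁ (refl , refl) | inj₁ (e₁ , e₂) = endsInj c d (cong₂ _,_ (sym e₁) (sym e₂))
  ... | inj₂ (refl , refl) | inj₂ (e₁ , e₂) = endsInj c d (cong₂ _,_ (sym e₁) (sym e₂))
  ... | inj₁ (refl , refl) | inj₂ (e₁ , e₂) = ⊥-elim (<-asym (endsOrd c) (subst₂ (λ u v → toℕ u < toℕ v) e₁ e₂ (endsOrd d)))
  ... | inj₂ (refl , refl) | inj₁ (e₁ , e₂) = ⊥-elim (<-asym (endsOrd c) (subst₂ (λ u v → toℕ u < toℕ v) e₁ e₂ (endsOrd d)))

  edgesOf : (Fin (k F) → Bool) → Sub H
  edgesOf S = record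
    { vs     = λ a → anyFin λ c → S c ∧ (⌊ a ≟ end₁ c ⌋ ∨ ⌊ a ≟ end₂ c ⌋)
    ; es     = λ a b → anyFin λ c → S c ∧ isEdgeOf c a b
    ; es-sym = λ a b → any-cong λ c → cong (S c ∧_) (isEdgeOf-sym c a b)
    ; es⊆    = λ a b t → in-H a b (any-witness _ t)
    ; es-end = λ a b t → endpoint a b (any-witness _ t)
    }
    where
    in-H : ∀ a b → (∃ λ c → T (S c ∧ isEdgeOf c a b)) → T (adj H a b)
    in-H a b (c , t) with isEdgeOf-cases c a b (∧-snd {S c} t)
    ... | inj₁ (refl , refl) = endsEdge c
    ... | inj₂ (refl , refl) = subst T (adj-sym H (end₁ c) (end₂ c)) (endsEdge c)
    endpoint : ∀ a b → (∃ λ c → T (S c ∧ isEdgeOf c a b)) → T (anyFin λ c → S c ∧ (⌊ a ≟ end₁ c ⌋ ∨ ⌊ a ≟ end₂ c ⌋))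
    endpoint a b (c , t) with isEdgeOf-cases c a b (∧-snd {S c} t)
    ... | inj₁ (refl , _) = any-intro _ c (∧-intro (∧-fst {S c} t) (∨-inl (≟-refl a)))
    ... | inj₂ (_ , refl) = any-intro _ c (∧-intro (∧-fst {S c} t) (∨-inr {⌊ a ≟ end₁ c ⌋} (≟-refl a)))

  edgesOf-size : ∀ S → countFin S ≤ eSub (edgesOf S)
  edgesOf-size S = begin
    countFin S                                                ≡⟨ countFin≡∑∈ S ⟩
    ∑[ c ∈ S ] 1                                              ≤⟨ ∑∈-mono-w S (λ c _ → own-edge c) ⟩
    ∑[ c ∈ S ] countPairs (isEdgeOf c)                        ≡⟨ sum-cong-≗ (λ c → sym (pairs-∧ (S c) (isEdgeOf c))) ⟩
    sum (λ c → countPairs (λ a b → S c ∧ isEdgeOf c a b))     ≡⟨ sym (pairs-union≡ (λ c a b → S c ∧ isEdgeOf c a b) distinct) ⟩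
    eSub (edgesOf S)                                          ∎
    where
    open ≤-Reasoning
    own-edge : ∀ c → 1 ≤ countPairs (isEdgeOf c)
    own-edge c = pairs-edge (isEdgeOf c) (isEdgeOf-sym c) (end₁ c) (end₂ c)
                   (λ e → <-irrefl (cong toℕ e) (endsOrd c)) (isEdgeOf-own c)
    distinct : ∀ a b c d → T (S c ∧ isEdgeOf c a b) → T (S d ∧ isEdgeOf d a b) → c ≡ d
    distinct a b c d t t′ = isEdgeOf-unique a b c d (∧-snd {S c} t) (∧-snd {S d} t′)

  onH : Fin (N F) → Bool
  onH = image ψ (λ _ → true)

  cv : Fin (k F) → Fin (N F) → Bool
  cv c = copyVert Tg (cp F c)

  copy-meets-H : ∀ c → countFin (λ x → cv c x ∧ onH x) ≤ 2
  copy-meets-H c = begin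
    countFin (λ x → cv c x ∧ onH x)                                   ≤⟨ count-mono inside ⟩
    countFin (λ x → ⌊ ψ (end₁ c) ≟ x ⌋ ∨ ⌊ ψ (end₂ c) ≟ x ⌋)             ≤⟨ count-∨ (λ x → ⌊ ψ (end₁ c) ≟ x ⌋) (λ x → ⌊ ψ (end₂ c) ≟ x ⌋) ⟩
    countFin (λ x → ⌊ ψ (end₁ c) ≟ x ⌋) + countFin (λ x → ⌊ ψ (end₂ c) ≟ x ⌋) ≡⟨ cong₂ _+_ (count-single (ψ (end₁ c))) (count-single (ψ (end₂ c))) ⟩
    2                                                                 ∎
    where
    open ≤-Reasoning
    inside : ∀ x → T (cv c x ∧ onH x) → T (⌊ ψ (end₁ c) ≟ x ⌋ ∨ ⌊ ψ (end₂ c) ≟ x ⌋)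
    inside x t with any-witness (λ i → ⌊ cp F c i ≟ x ⌋) (∧-fst {cv c x} t)
                  | image-witness ψ (λ _ → true) x (∧-snd {cv c x} t)
    ... | i , tᵢ | a , ψa≡x , _ with meetH c i a (trans (toWitness tᵢ) (sym ψa≡x))
    ...   | inj₁ refl = ∨-inl {b = ⌊ ψ (end₂ c) ≟ x ⌋} (fromWitness ψa≡x)
    ...   | inj₂ refl = ∨-inr {⌊ ψ (end₁ c) ≟ x ⌋} (fromWitness ψa≡x)

  private-vertices : ∀ c → vG Tg ∸ 2 ≤ countFin (λ x → cv c x ∧ not (onH x))
  private-vertices c = m≤n+o⇒m∸n≤o (vG Tg) 2 (begin
    vG Tg                                                          ≡⟨ sym (copy-vertices Tg (cp F c) (cpInj F c)) ⟩
    countFin (cv c)                                                ≡⟨ count-split (cv c) onH ⟩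
    countFin (λ x → cv c x ∧ onH x) + countFin (λ x → cv c x ∧ not (onH x)) ≤⟨ +-monoˡ-≤ _ (copy-meets-H c) ⟩
    2 + countFin (λ x → cv c x ∧ not (onH x))                      ∎)
    where open ≤-Reasoning

  off-H-disjoint : ∀ (S : Fin (k F) → Bool) x c d → T (S c ∧ (cv c x ∧ not (onH x))) → T (S d ∧ (cv d x ∧ not (onH x))) → c ≡ d
  off-H-disjoint S x c d t t′ with c ≟ d
  ... | yes c≡d = c≡d
  ... | no c≢d
    with any-witness (λ i → ⌊ cp F c i ≟ x ⌋) (∧-fst {cv c x} (∧-snd {S c} t))
       | any-witness (λ j → ⌊ cp F d j ≟ x ⌋) (∧-fst {cv d x} (∧-snd {S d} t′))
  ...   | i , tᵢ | j , tⱼ with otherwiseDisj c d c≢d i j (trans (toWitness tᵢ) (sym (toWitness tⱼ)))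
  ...     | a , eq = ⊥-elim (not-T (∧-snd {cv c x} (∧-snd {S c} t))
                        (subst (T ∘ onH) (trans (sym eq) (toWitness tᵢ)) (image-intro ψ (λ _ → true) a tt)))

  module _ (S : Fin (k F) → Bool) where

    on-H-vertices : vSub (edgesOf S) ≤ countFin (λ x → UVert F S x ∧ onH x)
    on-H-vertices = begin
      vSub (edgesOf S)                          ≡⟨ sym (count-image ψ ψInj (vs (edgesOf S))) ⟩
      countFin (image ψ (vs (edgesOf S)))       ≤⟨ count-mono inside ⟩
      countFin (λ x → UVert F S x ∧ onH x)      ∎
      where
      open ≤-Reasoning
      inside : ∀ x → T (image ψ (vs (edgesOf S)) x) → T (UVert F S x ∧ onH x)
      inside x t with image-witness ψ (vs (edgesOf S)) x t
      ... | a , refl , vs-a with any-witness _ vs-a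
      ...   | c , u = ∧-intro (any-intro (λ d → S d ∧ cv d (ψ a)) c (∧-intro (∧-fst {S c} u) on-copy))
                              (image-intro ψ (λ _ → true) a tt)
        where
        on-copy : T (cv c (ψ a))
        on-copy with ∨-elim {⌊ a ≟ end₁ c ⌋} (∧-snd {S c} u)
                   | copyEdge-ends Tg (cp F c) _ _ (hasEdge c)
        ... | inj₁ e | on₁ , _ = subst (T ∘ cv c ∘ ψ) (sym (toWitness e)) on₁
        ... | inj₂ e | _ , on₂ = subst (T ∘ cv c ∘ ψ) (sym (toWitness e)) on₂

    -- Off ψ(H) the selected copies are disjoint, each contributing ≥ v_T − 2 vertices.
    off-H-vertices : countFin S * (vG Tg ∸ 2) ≤ countFin (λ x → UVert F S x ∧ not (onH x))
    off-H-vertices = begin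
      countFin S * (vG Tg ∸ 2)                                        ≡⟨ sym (∑∈-const S (vG Tg ∸ 2)) ⟩
      ∑[ c ∈ S ] (vG Tg ∸ 2)                                          ≤⟨ ∑∈-mono-w S (λ c _ → private-vertices c) ⟩
      ∑[ c ∈ S ] countFin (λ x → cv c x ∧ not (onH x))                ≡⟨ sum-cong-≗ (λ c → sym (count-∧ (S c) (λ x → cv c x ∧ not (onH x)))) ⟩
      sum (λ c → countFin (λ x → S c ∧ (cv c x ∧ not (onH x))))       ≡⟨ sym (count-union≡ (λ c x → S c ∧ (cv c x ∧ not (onH x))) (off-H-disjoint S)) ⟩
      countFin (λ x → anyFin λ c → S c ∧ (cv c x ∧ not (onH x)))      ≡⟨ count-cong regroup ⟩
      countFin (λ x → UVert F S x ∧ not (onH x))                      ∎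
      where
      open ≤-Reasoning
      regroup : ∀ x → (anyFin λ c → S c ∧ (cv c x ∧ not (onH x))) ≡ UVert F S x ∧ not (onH x)
      regroup x = trans (any-cong λ c → sym (∧-assoc (S c) (cv c x) (not (onH x))))
                        (sym (any-∧ʳ (λ c → S c ∧ cv c x) (not (onH x))))

    union-vertices : vSub (edgesOf S) + countFin S * (vG Tg ∸ 2) ≤ vU F S
    union-vertices = subst (vSub (edgesOf S) + countFin S * (vG Tg ∸ 2) ≤_) (sym (count-split (UVert F S) onH))
                           (+-mono-≤ on-H-vertices off-H-vertices)

  density-≤ : TwoBalanced Tg → M2≤ H (eG Tg ∸ 1) (vG Tg ∸ 2) → MT≤ F (eG Tg ∸ 1) (vG Tg ∸ 2)
  density-≤ (eT≥2 , _) m₂H S s≥2 =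
    density-bound-≤ eT≥1 (graph-vertices≥2 Tg eT≥1) s≥1 (sub-vertices≥2 (edgesOf S) e′≥1)
      (edgesOf-size S) (union-vertices≥ F S c S-c) (union-edges≤ F S) (union-vertices S)
      (m₂H (edgesOf S) (≤-trans s≥2 (edgesOf-size S)))
    where
    eT≥1 : 1 ≤ eG Tg
    eT≥1 = ≤-trans (s≤s z≤n) eT≥2
    s≥1 : 1 ≤ countFin S
    s≥1 = ≤-trans (s≤s z≤n) s≥2
    e′≥1 : 1 ≤ eSub (edgesOf S)
    e′≥1 = ≤-trans s≥1 (edgesOf-size S)
    selected : ∃ λ c → T (S c)
    selected = count-witness S s≥1
    c : Fin (k F)
    c = proj₁ selected
    S-c : T (S c)
    S-c = proj₂ selected

module PartII {H Tg : Graph} (H′ : Sub H) {F : Collection Tg} (cov : IsCovering Tg H F) where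
  open IsCovering cov

  ψ : Fin (n H) → Fin (N F)
  ψ = proj₁ covers

  E : Fin (N F) → Fin (N F) → Bool
  E = imageRel ψ (es H′)

  X : Fin (N F) → Bool
  X = image ψ (vs H′)

  E-sym : ∀ x y → E x y ≡ E y x
  E-sym = imageRel-sym ψ (es H′) (es-sym H′)

  E-ends : ∀ x y → T (E x y) → T (X x)
  E-ends x y t with imageRel-witness ψ (es H′) x y t
  ... | a , b , refl , _ , tₐᵦ = image-intro ψ (vs H′) a (es-end H′ a b tₐᵦ)

  ce : Fin (k F) → Fin (N F) → Fin (N F) → Bool
  ce c = copyEdge Tg (cp F c)

  cv : Fin (k F) → Fin (N F) → Bool
  cv c = copyVert Tg (cp F c)

  Sel : Fin (k F) → Bool
  Sel c = anyFin λ x → anyFin λ y → E x y ∧ ce c x y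

  covered : ∀ x y → T (E x y) → ∃ λ c → T (Sel c ∧ (ce c x y ∧ E x y))
  covered x y t with imageRel-witness ψ (es H′) x y t
  ... | a , b , refl , refl , tₐᵦ
    with any-witness _ (proj₂ (proj₂ covers) a b (es⊆ H′ a b tₐᵦ))
  ...   | c , in-c = c , ∧-intro (any-intro _ (ψ a) (any-intro _ (ψ b) (∧-intro t in-c))) (∧-intro in-c t)

  trace : Fin (k F) → Sub Tg
  trace c = record
    { vs     = X ∘ cp F c
    ; es     = λ i j → adj Tg i j ∧ E (cp F c i) (cp F c j)
    ; es-sym = λ i j → cong₂ _∧_ (adj-sym Tg i j) (E-sym (cp F c i) (cp F c j))
    ; es⊆    = λ i j t → ∧-fst {adj Tg i j} t
    ; es-end = λ i j t → E-ends _ _ (∧-snd {adj Tg i j} t)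
    }

  trace-nonempty : ∀ c → T (Sel c) → 1 ≤ eSub (trace c)
  trace-nonempty c sel
    with any-witness _ sel
  ... | x , t with any-witness (λ y → E x y ∧ ce c x y) t
  ...   | y , t′ with copyEdge-witness Tg (cp F c) x y (∧-snd {E x y} t′)
  ...     | i , j , refl , refl , aᵢⱼ =
    pairs-edge (es (trace c)) (es-sym (trace c)) i j (adj-distinct Tg i j aᵢⱼ)
      (∧-intro aᵢⱼ (∧-fst {E (cp F c i) (cp F c j)} t′))

  s : ℕ
  s = countFin Sel

  EJ VJ : ℕ
  EJ = ∑[ c ∈ Sel ] eSub (trace c)
  VJ = ∑[ c ∈ Sel ] vSub (trace c)

  edges-covered : eSub H′ ≤ EJ
  edges-covered = begin
    eSub H′                                                    ≡⟨ sym (pairs-image ψ (proj₁ (proj₂ covers)) (es H′) (es-sym H′)) ⟩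
    countPairs E                                               ≤⟨ pairs-mono (λ x y t → any-intro (λ c → Sel c ∧ (ce c x y ∧ E x y)) _ (proj₂ (covered x y t))) ⟩
    countPairs (λ x y → anyFin λ c → Sel c ∧ (ce c x y ∧ E x y)) ≤⟨ pairs-union≤ (λ c x y → Sel c ∧ (ce c x y ∧ E x y)) ⟩
    sum (λ c → countPairs (λ x y → Sel c ∧ (ce c x y ∧ E x y))) ≡⟨ sum-cong-≗ (λ c → pairs-∧ (Sel c) (λ x y → ce c x y ∧ E x y)) ⟩
    ∑[ c ∈ Sel ] countPairs (λ x y → ce c x y ∧ E x y)        ≡⟨ sum-cong-≗ (λ c → cong (χ (Sel c) *_) (copy-edges-in Tg (cp F c) (cpInj F c) E E-sym)) ⟩
    EJ                                                         ∎
    where open ≤-Reasoning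

  trace-vertices : ∀ c → countFin (λ x → cv c x ∧ not (X x)) + vSub (trace c) ≡ vG Tg
  trace-vertices c = begin
    countFin (λ x → cv c x ∧ not (X x)) + vSub (trace c)               ≡⟨ cong (off +_) (sym (copy-vertices-in Tg (cp F c) (cpInj F c) X)) ⟩
    countFin (λ x → cv c x ∧ not (X x)) + countFin (λ x → cv c x ∧ X x) ≡⟨ +-comm off (countFin (λ x → cv c x ∧ X x)) ⟩
    countFin (λ x → cv c x ∧ X x) + countFin (λ x → cv c x ∧ not (X x)) ≡⟨ sym (count-split (cv c) X) ⟩
    countFin (cv c)                                                    ≡⟨ copy-vertices Tg (cp F c) (cpInj F c) ⟩
    vG Tg                                                              ∎
    where
    open ≡-Reasoning
    off : ℕ
    off = countFin (λ x → cv c x ∧ not (X x))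

  union-vertices : vU F Sel + VJ ≤ vSub H′ + s * vG Tg
  union-vertices = begin
    vU F Sel + VJ                                                      ≡⟨ cong (_+ VJ) (count-split (UVert F Sel) X) ⟩
    countFin (λ x → UVert F Sel x ∧ X x) + off + VJ                    ≤⟨ +-monoˡ-≤ VJ (+-mono-≤ on-H′ off-H′) ⟩
    vSub H′ + ∑[ c ∈ Sel ] countFin (λ x → cv c x ∧ not (X x)) + VJ    ≡⟨ +-assoc (vSub H′) _ VJ ⟩
    vSub H′ + (∑[ c ∈ Sel ] countFin (λ x → cv c x ∧ not (X x)) + VJ)  ≡⟨ cong (vSub H′ +_) (sym (∑∈-+ Sel (λ c → countFin (λ x → cv c x ∧ not (X x))) (vSub ∘ trace))) ⟩
    vSub H′ + ∑[ c ∈ Sel ] (countFin (λ x → cv c x ∧ not (X x)) + vSub (trace c)) ≡⟨ cong (vSub H′ +_) (sum-cong-≗ λ c → cong (χ (Sel c) *_) (trace-vertices c)) ⟩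
    vSub H′ + ∑[ c ∈ Sel ] vG Tg                                       ≡⟨ cong (vSub H′ +_) (∑∈-const Sel (vG Tg)) ⟩
    vSub H′ + s * vG Tg                                                ∎
    where
    open ≤-Reasoning
    off : ℕ
    off = countFin (λ x → UVert F Sel x ∧ not (X x))
    on-H′ : countFin (λ x → UVert F Sel x ∧ X x) ≤ vSub H′
    on-H′ = ≤-trans (count-mono (λ x → ∧-snd {UVert F Sel x}))
                    (≤-reflexive (count-image ψ (proj₁ (proj₂ covers)) (vs H′)))
    off-H′ : off ≤ ∑[ c ∈ Sel ] countFin (λ x → cv c x ∧ not (X x))
    off-H′ = begin
      off                                                          ≡⟨ count-cong (λ x → trans (any-∧ʳ (λ c → Sel c ∧ cv c x) (not (X x)))
                                                                                       (any-cong λ c → ∧-assoc (Sel c) (cv c x) (not (X x)))) ⟩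
      countFin (λ x → anyFin λ c → Sel c ∧ (cv c x ∧ not (X x)))   ≤⟨ count-union≤ (λ c x → Sel c ∧ (cv c x ∧ not (X x))) ⟩
      sum (λ c → countFin (λ x → Sel c ∧ (cv c x ∧ not (X x))))    ≡⟨ sum-cong-≗ (λ c → count-∧ (Sel c) (λ x → cv c x ∧ not (X x))) ⟩
      ∑[ c ∈ Sel ] countFin (λ x → cv c x ∧ not (X x))             ∎

  traces-dense : TwoBalanced Tg →
    (vG Tg ∸ 2) * EJ + s * (2 * (eG Tg ∸ 1)) ≤ (eG Tg ∸ 1) * VJ + s * (vG Tg ∸ 2)
  traces-dense TB = begin
    a * EJ + s * (2 * b)                                  ≡⟨ sym (cong₂ _+_ (∑∈-scale Sel a (eSub ∘ trace)) (∑∈-const Sel (2 * b))) ⟩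
    ∑[ c ∈ Sel ] (a * eSub (trace c)) + ∑[ c ∈ Sel ] (2 * b) ≡⟨ sym (∑∈-+ Sel (λ c → a * eSub (trace c)) (λ _ → 2 * b)) ⟩
    ∑[ c ∈ Sel ] (a * eSub (trace c) + 2 * b)             ≤⟨ ∑∈-mono-w Sel (λ c sel → balanced-sub TB (trace c) (trace-nonempty c sel)) ⟩
    ∑[ c ∈ Sel ] (b * vSub (trace c) + a)                 ≡⟨ ∑∈-+ Sel (λ c → b * vSub (trace c)) (λ _ → a) ⟩
    ∑[ c ∈ Sel ] (b * vSub (trace c)) + ∑[ c ∈ Sel ] a    ≡⟨ cong₂ _+_ (∑∈-scale Sel b (vSub ∘ trace)) (∑∈-const Sel a) ⟩
    b * VJ + s * a                                        ∎
    where
    open ≤-Reasoning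
    a b : ℕ
    a = vG Tg ∸ 2
    b = eG Tg ∸ 1

  density-> : TwoBalanced Tg → 2 ≤ eSub H′ →
    (eSub H′ ∸ 1) / (vSub H′ ∸ 2) >' (eG Tg ∸ 1) / (vG Tg ∸ 2) → MT> F (eG Tg ∸ 1) (vG Tg ∸ 2)
  density-> TB e′≥2 dense = Sel ,
    density-bound-> eT≥1 (graph-vertices≥2 Tg eT≥1) (count-member Sel c Sel-c)
      (sub-vertices≥2 H′ e′≥1) e′≥1 (union-vertices≥ F Sel c Sel-c) edges-covered
      (union-edges≡ F disjoint Sel) union-vertices (traces-dense TB) dense
    where
    eT≥1 : 1 ≤ eG Tg
    eT≥1 = ≤-trans (s≤s z≤n) (proj₁ TB)
    e′≥1 : 1 ≤ eSub H′
    e′≥1 = ≤-trans (s≤s z≤n) e′≥2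
    edge : ∃ λ a → ∃ λ b → a ≢ b × T (es H′ a b)
    edge = pairs-witness (es H′) e′≥1
    a b : Fin (n H)
    a = proj₁ edge
    b = proj₁ (proj₂ edge)
    selected : ∃ λ c → T (Sel c ∧ (ce c (ψ a) (ψ b) ∧ E (ψ a) (ψ b)))
    selected = covered (ψ a) (ψ b) (imageRel-intro ψ (es H′) a b (proj₂ (proj₂ (proj₂ edge))))
    c : Fin (k F)
    c = proj₁ selected
    Sel-c : T (Sel c)
    Sel-c = ∧-fst {Sel c} (proj₂ selected)

lemma3p6 : (H Tg : Graph) → TwoBalanced Tg →
    ((2 ≤ eG H → M2≤ H (eG Tg ∸ 1) (vG Tg ∸ 2) →
    ∀ (F : Collection Tg) → IsFe Tg H F → MT≤ F (eG Tg ∸ 1) (vG Tg ∸ 2))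
    × (M2> H (eG Tg ∸ 1) (vG Tg ∸ 2) →
    ∀ (F : Collection Tg) → IsCovering Tg H F → MT> F (eG Tg ∸ 1) (vG Tg ∸ 2)))
lemma3p6 H Tg TB = part-i , part-ii
  where
  part-i : 2 ≤ eG H → M2≤ H (eG Tg ∸ 1) (vG Tg ∸ 2) →
    ∀ (F : Collection Tg) → IsFe Tg H F → MT≤ F (eG Tg ∸ 1) (vG Tg ∸ 2)
  part-i _ m₂H F fe = PartI.density-≤ fe TB m₂H
  part-ii : M2> H (eG Tg ∸ 1) (vG Tg ∸ 2) →
    ∀ (F : Collection Tg) → IsCovering Tg H F → MT> F (eG Tg ∸ 1) (vG Tg ∸ 2)
  part-ii (H′ , e′≥2 , dense) F cov = PartII.density-> H′ cov TB e′≥2 dense
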